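{- Let $\Delta$ be a finite simplicial complex and let $k > p > 0$ be integers. Suppose that $f_{p-1}(\Delta) > 0$. Then $$f_{p-1}(\Delta) > \frac{(k!)^{p/k}}{p!}\big(f_{k-1}(\Delta)\big)^{p/k}.$$
   Context: A simplicial complex $\Delta$ on a finite vertex set $W$ is a collection of subsets of $W$ (faces) such that $\{v\}\in\Delta$ for every $v\in W$ and every subset of a face is a face. For $i \ge 1$, $f_{i-1}(\Delta)$ denotes the number of faces of $\Delta$ having exactly $i$ vertices. -}

module Defs where

open import Data.Nat using (ℕ; zero; suc)
open import Data.Bool using (Bool; true; false; _∧_)
open import Data.Fin using (Fin)
open import Data.Fin.Subset using (Subset; Side; inside; outside; ∣_∣; _⊆_; ⁅_⁆)
open import Data.List using (List; []; _∷_; _++_; map; filterᵇ; length)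
open import Data.Vec using (Vec; []; _∷_)
open import Relation.Binary.PropositionalEquality using (_≡_)
open import Data.Nat using (_≟_)
open import Relation.Nullary.Decidable using (⌊_⌋)

record SimplicialComplex (n : ℕ) : Set where
  field
    isFace     : Subset n → Bool
    singletons : ∀ (v : Fin n) → isFace ⁅ v ⁆ ≡ true
    downClosed : ∀ (S T : Subset n) → S ⊆ T → isFace T ≡ true → isFace S ≡ true

open SimplicialComplex public

allSubsets : (n : ℕ) → List (Subset n)
allSubsets zero    = [] ∷ []
allSubsets (suc n) = map (inside ∷_) (allSubsets n) ++ map (outside ∷_) (allSubsets n)

-- f i Δ = f_{i-1}(Δ) : number of faces of Δ with exactly i vertices.
f : ∀ {n} → ℕ → SimplicialComplex n → ℕ
f {n} i Δ = length (filterᵇ (λ S → isFace Δ S ∧ ⌊ ∣ S ∣ ≟ i ⌋) (allSubsets n))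

-- Let a m = m! · f m count the ordered faces: injective m-tuples of vertices
-- spanning a face. The ordered (m+2)-faces form a set of tuples whose one-point
-- deletions are ordered (m+1)-faces, and each slice of tuples with a fixed first
-- entry x misses an ordered (m+1)-face starting with x. A Loomis–Whitney
-- argument (induction on the length, recombining slices by a mediant
-- inequality) then gives a (m+2) ^ (m+1) < a (m+1) ^ (m+2) whenever a (m+1) > 0,
-- i.e. the m-th root of a m strictly decreases; so a k ^ p < a p ^ k for
-- 0 < p < k, which is the claim.
module Submission where

open import Defs
open import Data.Nat using (ℕ; _<_; _*_; _^_; _!)
open import Data.Nat
  using (zero; suc; _+_; _≤_; pred; NonZero; >-nonZero; z≤n; s≤s; z<s; _≟_)
open import Data.Nat using (_<′_; ≤′-refl; ≤′-step)
open import Data.Nat.Properties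
open import Data.Bool using (Bool; true; false; _∧_; not)
open import Data.Bool.Properties using (∧-identityʳ; ∧-zeroʳ)
open import Data.Fin using (Fin; zero; suc)
open import Data.Fin.Subset using (Subset; inside; outside; ⊥; ∣_∣; _∈_; _⊆_)
open import Data.Vec using (Vec; []; _∷_; lookup; removeAt; _[_]≔_; here; there)
open import Data.Vec.Properties using (lookup⇒[]=; []=⇒lookup; lookup∘update)
open import Data.List using (List; []; _∷_; _++_; map; filterᵇ; length)
open import Data.List.Properties using (length-++; filter-++)
open import Data.Product using (∃; _,_)
open import Data.Sum as Sum using (_⊎_; inj₁; inj₂)
open import Function using (_∘_)
open import Relation.Binary.PropositionalEquality
open import Relation.Nullary using (yes; no; contradiction)
open import Relation.Nullary.Decidable using (⌊_⌋)
open import Algebra.Properties.Semiring.Sum +-*-semiring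
  using (sum; sum-syntax; sum-cong-≗; sum-replicate-zero; ∑-distrib-+; *-distribˡ-sum)

private
  variable
    n m k : ℕ

^-distribʳ-* : ∀ x y r → (x * y) ^ r ≡ x ^ r * y ^ r
^-distribʳ-* x y zero    = refl
^-distribʳ-* x y (suc r) = begin
  x * y * (x * y) ^ r      ≡⟨ cong (x * y *_) (^-distribʳ-* x y r) ⟩
  x * y * (x ^ r * y ^ r)  ≡⟨ [m*n]*[o*p]≡[m*o]*[n*p] x y (x ^ r) (y ^ r) ⟩
  x * x ^ r * (y * y ^ r)  ∎
  where open ≡-Reasoning

^-^-comm : ∀ x r s → (x ^ r) ^ s ≡ (x ^ s) ^ r
^-^-comm x r s = trans (^-*-assoc x r s) (trans (cong (x ^_) (*-comm r s)) (sym (^-*-assoc x s r)))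

0^r≡0 : ∀ r .{{_ : NonZero r}} → 0 ^ r ≡ 0
0^r≡0 (suc r) = refl

^-cancelʳ-< : ∀ r .{{_ : NonZero r}} {x y} → x ^ r < y ^ r → x < y
^-cancelʳ-< r xʳ<yʳ = ≰⇒> (λ y≤x → <⇒≱ xʳ<yʳ (^-monoˡ-≤ r y≤x))

-- If a/b ≥ A/B then the mediant (a+A)/(b+B) is at most a/b; this replaces
-- taking r-th roots of the bounds a ≤ c^{1/r} b and A ≤ c^{1/r} B.
mediant-^-bound : ∀ r .{{_ : NonZero r}} c {a A b B} → A * b ≤ a * B →
  a ^ r ≤ c * b ^ r → A ^ r ≤ c * B ^ r → (a + A) ^ r ≤ c * (b + B) ^ r
mediant-^-bound r c {a} {A} {zero} {B} _ aʳ≤0 Aʳ≤cBʳ =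
  subst (λ a → (a + A) ^ r ≤ c * B ^ r) (sym a≡0) Aʳ≤cBʳ
  where
  a≡0 : a ≡ 0
  a≡0 = m^n≡0⇒m≡0 a r (n≤0⇒n≡0 (subst (a ^ r ≤_) c*0ʳ≡0 aʳ≤0))
    where c*0ʳ≡0 = trans (cong (c *_) (0^r≡0 r)) (*-zeroʳ c)
mediant-^-bound r c {a} {A} {b@(suc _)} {B} Ab≤aB aʳ≤cbʳ _ =
  *-cancelʳ-≤ ((a + A) ^ r) (c * (b + B) ^ r) (b ^ r) {{m^n≢0 b r}} (begin
    (a + A) ^ r * b ^ r    ≡⟨ ^-distribʳ-* (a + A) b r ⟨
    ((a + A) * b) ^ r      ≤⟨ ^-monoˡ-≤ r mediant ⟩
    (a * (b + B)) ^ r      ≡⟨ ^-distribʳ-* a (b + B) r ⟩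
    a ^ r * (b + B) ^ r    ≤⟨ *-monoˡ-≤ ((b + B) ^ r) aʳ≤cbʳ ⟩
    c * b ^ r * (b + B) ^ r ≡⟨ *-assoc c (b ^ r) _ ⟩
    c * (b ^ r * (b + B) ^ r) ≡⟨ cong (c *_) (*-comm (b ^ r) _) ⟩
    c * ((b + B) ^ r * b ^ r) ≡⟨ *-assoc c _ (b ^ r) ⟨
    c * (b + B) ^ r * b ^ r ∎)
  where
  open ≤-Reasoning
  mediant : (a + A) * b ≤ a * (b + B)
  mediant = begin
    (a + A) * b     ≡⟨ *-distribʳ-+ b a A ⟩
    a * b + A * b   ≤⟨ +-monoʳ-≤ (a * b) Ab≤aB ⟩
    a * b + a * B   ≡⟨ *-distribˡ-+ a b B ⟨
    a * (b + B)     ∎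

+-preserves-^-bound : ∀ r .{{_ : NonZero r}} c {a A b B} →
  a ^ r ≤ c * b ^ r → A ^ r ≤ c * B ^ r → (a + A) ^ r ≤ c * (b + B) ^ r
+-preserves-^-bound r c {a} {A} {b} {B} aʳ≤cbʳ Aʳ≤cBʳ with ≤-total (A * b) (a * B)
... | inj₁ Ab≤aB = mediant-^-bound r c Ab≤aB aʳ≤cbʳ Aʳ≤cBʳ
... | inj₂ aB≤Ab = subst₂ (λ u v → u ^ r ≤ c * v ^ r) (+-comm A a) (+-comm B b)
                     (mediant-^-bound r c aB≤Ab Aʳ≤cBʳ aʳ≤cbʳ)

∑-preserves-^-bound : ∀ r .{{_ : NonZero r}} c (g h : Fin n → ℕ) →
  (∀ i → g i ^ r ≤ c * h i ^ r) → sum g ^ r ≤ c * sum h ^ r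
∑-preserves-^-bound {zero}  r c g h _ = subst (_≤ c * 0 ^ r) (sym (0^r≡0 r)) z≤n
∑-preserves-^-bound {suc n} r c g h bound =
  +-preserves-^-bound r c (bound zero) (∑-preserves-^-bound r c (g ∘ suc) (h ∘ suc) (bound ∘ suc))

∑-mono-≤ : (g h : Fin n → ℕ) → (∀ i → g i ≤ h i) → sum g ≤ sum h
∑-mono-≤ {zero}  g h g≤h = z≤n
∑-mono-≤ {suc n} g h g≤h = +-mono-≤ (g≤h zero) (∑-mono-≤ (g ∘ suc) (h ∘ suc) (g≤h ∘ suc))

∑-mono-< : (g h : Fin n → ℕ) → (∀ i → g i ≤ h i) → ∀ j → g j < h j → sum g < sum h
∑-mono-< {suc n} g h g≤h zero    gj<hj =
  +-mono-<-≤ gj<hj (∑-mono-≤ (g ∘ suc) (h ∘ suc) (g≤h ∘ suc))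
∑-mono-< {suc n} g h g≤h (suc j) gj<hj =
  +-mono-≤-< (g≤h zero) (∑-mono-< (g ∘ suc) (h ∘ suc) (g≤h ∘ suc) j gj<hj)

∑-positive : (g : Fin n → ℕ) → 0 < sum g → ∃ λ i → 0 < g i
∑-positive {suc n} g ∑g>0 with g zero in g₀≡
... | suc _ = zero , subst (0 <_) (sym g₀≡) z<s
... | zero with ∑-positive (g ∘ suc) ∑g>0
...   | i , gi>0 = suc i , gi>0

χ : Bool → ℕ
χ true  = 1
χ false = 0

∑ˢ : (Subset n → ℕ) → ℕ
∑ˢ {zero}  g = g []
∑ˢ {suc n} g = ∑ˢ (λ S → g (inside ∷ S)) + ∑ˢ (λ S → g (outside ∷ S))

#ˢ : (Subset n → Bool) → ℕ
#ˢ Q = ∑ˢ (χ ∘ Q)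

∑ˢ-cong : (g h : Subset n → ℕ) → (∀ S → g S ≡ h S) → ∑ˢ g ≡ ∑ˢ h
∑ˢ-cong {zero}  g h g≗h = g≗h []
∑ˢ-cong {suc n} g h g≗h =
  cong₂ _+_ (∑ˢ-cong _ _ (g≗h ∘ (inside ∷_))) (∑ˢ-cong _ _ (g≗h ∘ (outside ∷_)))

∑ˢ-zero : ∑ˢ {n} (λ _ → 0) ≡ 0
∑ˢ-zero {zero}  = refl
∑ˢ-zero {suc n} = cong₂ _+_ (∑ˢ-zero {n}) (∑ˢ-zero {n})

∑ˢ-*-distribʳ : (g : Subset n → ℕ) (c : ℕ) → ∑ˢ (λ S → g S * c) ≡ ∑ˢ g * c
∑ˢ-*-distribʳ {zero}  g c = refl
∑ˢ-*-distribʳ {suc n} g c =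
  trans (cong₂ _+_ (∑ˢ-*-distribʳ (g ∘ (inside ∷_)) c) (∑ˢ-*-distribʳ (g ∘ (outside ∷_)) c))
        (sym (*-distribʳ-+ c (∑ˢ (g ∘ (inside ∷_))) _))

∑-∑ˢ-comm : (G : Fin k → Subset n → ℕ) →
  ∑[ x < k ] ∑ˢ (G x) ≡ ∑ˢ (λ S → ∑[ x < k ] G x S)
∑-∑ˢ-comm {k} {zero}  G = refl
∑-∑ˢ-comm {k} {suc n} G = trans (∑-distrib-+ (λ x → ∑ˢ (λ S → G x (inside ∷ S))) _)
  (cong₂ _+_ (∑-∑ˢ-comm (λ x S → G x (inside ∷ S)))
             (∑-∑ˢ-comm (λ x S → G x (outside ∷ S))))

-- A Loomis–Whitney inequality for sets of tuples

count : ∀ m → (Vec (Fin n) m → Bool) → ℕ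
count         zero    Q = χ (Q [])
count {n = n} (suc m) Q = ∑[ x < n ] count m (λ v → Q (x ∷ v))

count-cong : ∀ m (A B : Vec (Fin n) m → Bool) → (∀ v → A v ≡ B v) → count m A ≡ count m B
count-cong zero    A B A≗B = cong χ (A≗B [])
count-cong (suc m) A B A≗B = sum-cong-≗ (λ x → count-cong m _ _ (A≗B ∘ (x ∷_)))

χ-mono : ∀ a b → (a ≡ true → b ≡ true) → χ a ≤ χ b
χ-mono false b a⇒b = z≤n
χ-mono true  b a⇒b rewrite a⇒b refl = ≤-refl

count-mono : ∀ m (A B : Vec (Fin n) m → Bool) → (∀ v → A v ≡ true → B v ≡ true) →
  count m A ≤ count m B
count-mono zero    A B A⇒B = χ-mono _ _ (A⇒B [])
count-mono (suc m) A B A⇒B = ∑-mono-≤ _ _ (λ x → count-mono m _ _ (A⇒B ∘ (x ∷_)))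

count-mono-< : ∀ m (A B : Vec (Fin n) m → Bool) → (∀ v → A v ≡ true → B v ≡ true) →
  ∀ w → A w ≡ false → B w ≡ true → count m A < count m B
count-mono-< zero    A B A⇒B [] Aw≡false Bw≡true rewrite Aw≡false | Bw≡true = z<s
count-mono-< (suc m) A B A⇒B (x ∷ w) Aw≡false Bw≡true =
  ∑-mono-< _ _ (λ y → count-mono m _ _ (A⇒B ∘ (y ∷_))) x
    (count-mono-< m _ _ (A⇒B ∘ (x ∷_)) w Aw≡false Bw≡true)

count-positive : ∀ m (A : Vec (Fin n) m → Bool) → 0 < count m A → ∃ λ w → A w ≡ true
count-positive zero A count>0 with A [] in A[]≡
... | true = [] , A[]≡
count-positive zero A () | false
count-positive (suc m) A count>0 with ∑-positive _ count>0
... | x , slice>0 with count-positive m _ slice>0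
...   | w , Axw≡true = x ∷ w , Axw≡true

count-none : ∀ m (A : Vec (Fin n) m → Bool) → (∀ v → A v ≡ false) → count m A ≡ 0
count-none         zero    A none = cong χ (none [])
count-none {n = n} (suc m) A none =
  trans (sum-cong-≗ (λ x → count-none m _ (none ∘ (x ∷_)))) (sum-replicate-zero n)

slice : (Vec (Fin n) (suc m) → Bool) → Fin n → Vec (Fin n) m → Bool
slice T x t = T (x ∷ t)

DeletionsIn : (Vec (Fin n) (suc m) → Bool) → (Vec (Fin n) m → Bool) → Set
DeletionsIn T S = ∀ i t → T t ≡ true → S (removeAt t i) ≡ true

-- The form |T|^{m+1} ≤ |T| |S|^{m+1} of |T|^m ≤ |S|^{m+1} also covers m = 0.
mutual
  loomis-whitney : ∀ m (T : Vec (Fin n) (suc m) → Bool) S → DeletionsIn T S →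
    count (suc m) T ^ suc m ≤ count (suc m) T * count m S ^ suc m
  loomis-whitney zero T S T⊑S with S [] in S[]≡
  ... | true  = ≤-refl
  ... | false = subst (λ t → t ^ 1 ≤ t * 0) (sym (count-none 1 T T-empty)) ≤-refl
    where
    T-empty : ∀ t → T t ≡ false
    T-empty (x ∷ []) with T (x ∷ []) in Tx≡
    ... | false = refl
    ... | true  = trans (sym (T⊑S zero (x ∷ []) Tx≡)) S[]≡
  loomis-whitney (suc m) T S T⊑S =
    *-monoʳ-≤ (count (2 + m) T)
      (loomis-whitney-sliced m T S T⊑S (count (suc m) S)
        (λ x → count-mono (suc m) _ _ (λ t → T⊑S zero (x ∷ t))))

  loomis-whitney-sliced : ∀ m (T : Vec (Fin n) (2 + m) → Bool) S → DeletionsIn T S →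
    ∀ c → (∀ x → count (suc m) (slice T x) ≤ c) →
    count (2 + m) T ^ suc m ≤ c * count (suc m) S ^ suc m
  loomis-whitney-sliced m T S T⊑S c slice≤c = ∑-preserves-^-bound (suc m) c _ _ λ x →
    ≤-trans (loomis-whitney m (slice T x) (slice S x) (slice-deletions x))
            (*-monoˡ-≤ _ (slice≤c x))
    where
    slice-deletions : ∀ x → DeletionsIn (slice T x) (slice S x)
    slice-deletions x i (y ∷ t) = T⊑S (suc i) (x ∷ y ∷ t)

-- Ordered faces

elements : Vec (Fin n) m → Subset n
elements []      = ⊥
elements (x ∷ v) = elements v [ x ]≔ inside

distinct : Vec (Fin n) m → Bool
distinct []      = true
distinct (x ∷ v) = not (lookup (elements v) x) ∧ distinct v

∈-insert⁻ : ∀ {y} x (S : Subset n) → y ∈ S [ x ]≔ inside → y ≡ x ⊎ y ∈ S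
∈-insert⁻ zero    (_ ∷ S) here      = inj₁ refl
∈-insert⁻ zero    (_ ∷ S) (there p) = inj₂ (there p)
∈-insert⁻ (suc x) (_ ∷ S) here      = inj₂ here
∈-insert⁻ (suc x) (_ ∷ S) (there p) = Sum.map (cong suc) there (∈-insert⁻ x S p)

∈-insert⁺ : ∀ {y} x (S : Subset n) → y ∈ S → y ∈ S [ x ]≔ inside
∈-insert⁺ zero    (_ ∷ S) here      = here
∈-insert⁺ zero    (_ ∷ S) (there p) = there p
∈-insert⁺ (suc x) (_ ∷ S) here      = here
∈-insert⁺ (suc x) (_ ∷ S) (there p) = there (∈-insert⁺ x S p)

insert-mono-⊆ : ∀ x (S T : Subset n) → S ⊆ T → S [ x ]≔ inside ⊆ T [ x ]≔ inside
insert-mono-⊆ x S T S⊆T p with ∈-insert⁻ x S p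
... | inj₁ refl = lookup⇒[]= x _ (lookup∘update x T inside)
... | inj₂ q    = ∈-insert⁺ x T (S⊆T q)

elements-removeAt-⊆ : (t : Vec (Fin n) (suc m)) (i : Fin (suc m)) →
  elements (removeAt t i) ⊆ elements t
elements-removeAt-⊆ (x ∷ t)     zero    = ∈-insert⁺ x (elements t)
elements-removeAt-⊆ (x ∷ y ∷ t) (suc i) = insert-mono-⊆ x _ _ (elements-removeAt-⊆ (y ∷ t) i)

⊆-lookup-false : ∀ {x} (S T : Subset n) → S ⊆ T → lookup T x ≡ false → lookup S x ≡ false
⊆-lookup-false {x = x} S T S⊆T Tx≡false with lookup S x in Sx≡
... | false = refl
... | true  = trans (sym ([]=⇒lookup (S⊆T (lookup⇒[]= x S Sx≡)))) Tx≡false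

∧-true⁻ˡ : ∀ {a b} → a ∧ b ≡ true → a ≡ true
∧-true⁻ˡ {true} _ = refl

∧-true⁻ʳ : ∀ {a b} → a ∧ b ≡ true → b ≡ true
∧-true⁻ʳ {true} ab = ab

∧-true⁺ : ∀ {a b} → a ≡ true → b ≡ true → a ∧ b ≡ true
∧-true⁺ refl refl = refl

not-true⁻ : ∀ {a} → not a ≡ true → a ≡ false
not-true⁻ {false} _ = refl

not-true⁺ : ∀ {a} → a ≡ false → not a ≡ true
not-true⁺ refl = refl

distinct-removeAt : (t : Vec (Fin n) (suc m)) (i : Fin (suc m)) →
  distinct t ≡ true → distinct (removeAt t i) ≡ true
distinct-removeAt (x ∷ t)     zero    = ∧-true⁻ʳ
distinct-removeAt (x ∷ y ∷ t) (suc i) distinct-xyt = ∧-true⁺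
  (not-true⁺ (⊆-lookup-false _ _ (elements-removeAt-⊆ (y ∷ t) i) x∉yt))
  (distinct-removeAt (y ∷ t) i (∧-true⁻ʳ {not (lookup (elements (y ∷ t)) x)} distinct-xyt))
  where
  x∉yt : lookup (elements (y ∷ t)) x ≡ false
  x∉yt = not-true⁻ (∧-true⁻ˡ distinct-xyt)

orderedFace : SimplicialComplex n → ∀ m → Vec (Fin n) m → Bool
orderedFace Δ m v = distinct v ∧ isFace Δ (elements v)

orderedFace-deletions : (Δ : SimplicialComplex n) → ∀ m →
  DeletionsIn (orderedFace Δ (suc m)) (orderedFace Δ m)
orderedFace-deletions Δ m i t face-t = ∧-true⁺
  (distinct-removeAt t i (∧-true⁻ˡ face-t))
  (downClosed Δ _ _ (elements-removeAt-⊆ t i) (∧-true⁻ʳ {distinct t} face-t))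

#orderedFaces : SimplicialComplex n → ℕ → ℕ
#orderedFaces Δ m = count m (orderedFace Δ m)

-- A slice x ∷ _ of ordered (m+2)-faces misses the ordered (m+1)-face x ∷ t′
-- obtained from any of its members x ∷ y ∷ t′.
slice-bound : (Δ : SimplicialComplex n) → ∀ m x →
  count (suc m) (slice (orderedFace Δ (2 + m)) x) ≤ pred (#orderedFaces Δ (suc m))
slice-bound Δ m x with count (suc m) (slice (orderedFace Δ (2 + m)) x) in slice≡
... | zero  = z≤n
... | suc _ with count-positive (suc m) (slice (orderedFace Δ (2 + m)) x) (subst (0 <_) (sym slice≡) z<s)
...   | y ∷ t′ , face-xyt′ = subst (_≤ pred (#orderedFaces Δ (suc m))) slice≡
          (<⇒≤pred (count-mono-< (suc m) (slice (orderedFace Δ (2 + m)) x) (orderedFace Δ (suc m))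
                                  slice⇒face (x ∷ t′) not-distinct face-xt′))
  where
  slice⇒face : ∀ t → slice (orderedFace Δ (2 + m)) x t ≡ true → orderedFace Δ (suc m) t ≡ true
  slice⇒face t = orderedFace-deletions Δ (suc m) zero (x ∷ t)
  face-xt′ : orderedFace Δ (suc m) (x ∷ t′) ≡ true
  face-xt′ = orderedFace-deletions Δ (suc m) (suc zero) (x ∷ y ∷ t′) face-xyt′
  not-distinct : slice (orderedFace Δ (2 + m)) x (x ∷ t′) ≡ false
  not-distinct rewrite lookup∘update x (elements t′) inside = refl

orderedFaces-shrink : (Δ : SimplicialComplex n) → ∀ m →
  #orderedFaces Δ (2 + m) ^ suc m ≤ pred (#orderedFaces Δ (suc m)) * #orderedFaces Δ (suc m) ^ suc m
orderedFaces-shrink Δ m = loomis-whitney-sliced m (orderedFace Δ (2 + m)) (orderedFace Δ (suc m))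
  (orderedFace-deletions Δ (suc m)) _ (slice-bound Δ m)

sized : Subset n → ℕ → Bool
sized S m = ⌊ ∣ S ∣ ≟ m ⌋

sized⇒∣∣≡ : ∀ (S : Subset n) {m} → sized S m ≡ true → ∣ S ∣ ≡ m
sized⇒∣∣≡ S {m} S-sized with ∣ S ∣ ≟ m
sized⇒∣∣≡ S {m} S-sized | yes ∣S∣≡m = ∣S∣≡m
sized⇒∣∣≡ S {m} ()       | no _

⌊suc≟suc⌋ : ∀ a b → ⌊ suc a ≟ suc b ⌋ ≡ ⌊ a ≟ b ⌋
⌊suc≟suc⌋ a b with a ≟ b | suc a ≟ suc b
... | yes _   | yes _     = refl
... | no _    | no _      = refl
... | yes a≡b | no 1+a≢1+b = contradiction (cong suc a≡b) 1+a≢1+b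
... | no a≢b  | yes 1+a≡1+b = contradiction (suc-injective 1+a≡1+b) a≢b

∣insert∣ : ∀ x (S : Subset n) → lookup S x ≡ false → ∣ S [ x ]≔ inside ∣ ≡ suc ∣ S ∣
∣insert∣ zero    (outside ∷ S) _ = refl
∣insert∣ (suc x) (inside ∷ S)  x∉S = cong suc (∣insert∣ x S x∉S)
∣insert∣ (suc x) (outside ∷ S) x∉S = ∣insert∣ x S x∉S

∑-lookup : (S : Subset n) (q : Bool) → ∑[ x < n ] χ (lookup S x ∧ q) ≡ χ q * ∣ S ∣
∑-lookup []            q = sym (*-zeroʳ (χ q))
∑-lookup (outside ∷ S) q = ∑-lookup S q
∑-lookup (inside ∷ S)  q = trans (cong (χ q +_) (∑-lookup S q)) (sym (*-suc (χ q) ∣ S ∣))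

-- Double counting of the incidences x ∈ S.
∑-#ˢ-member : ∀ c (Q : Subset n → Bool) → (∀ S → Q S ≡ true → ∣ S ∣ ≡ c) →
  ∑[ x < n ] #ˢ (λ S → lookup S x ∧ Q S) ≡ #ˢ Q * c
∑-#ˢ-member c Q size = begin
  ∑[ x < _ ] #ˢ (λ S → lookup S x ∧ Q S)
    ≡⟨ ∑-∑ˢ-comm (λ x S → χ (lookup S x ∧ Q S)) ⟩
  ∑ˢ (λ S → ∑[ x < _ ] χ (lookup S x ∧ Q S))
    ≡⟨ ∑ˢ-cong _ _ (λ S → trans (∑-lookup S (Q S)) (sized-weight S)) ⟩
  ∑ˢ (λ S → χ (Q S) * c)
    ≡⟨ ∑ˢ-*-distribʳ (χ ∘ Q) c ⟩
  #ˢ Q * c ∎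
  where
  open ≡-Reasoning
  sized-weight : ∀ S → χ (Q S) * ∣ S ∣ ≡ χ (Q S) * c
  sized-weight S with Q S in QS≡
  ... | true  = cong (1 *_) (size S QS≡)
  ... | false = refl

-- S ↦ S ∪ {x} is a bijection from the subsets avoiding x to those containing x.
#ˢ-insert : ∀ x (Q : Subset n → Bool) →
  #ˢ (λ S → not (lookup S x) ∧ Q (S [ x ]≔ inside)) ≡ #ˢ (λ S → lookup S x ∧ Q S)
#ˢ-insert {suc n} zero    Q = +-comm (∑ˢ {n} (λ _ → 0)) _
#ˢ-insert (suc x) Q = cong₂ _+_ (#ˢ-insert x (Q ∘ (inside ∷_))) (#ˢ-insert x (Q ∘ (outside ∷_)))

#ˢ-sized-zero : (Q : Subset n → Bool) → #ˢ (λ S → Q S ∧ sized S 0) ≡ χ (Q ⊥)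
#ˢ-sized-zero {zero}  Q = cong χ (∧-identityʳ (Q []))
#ˢ-sized-zero {suc n} Q = cong₂ _+_
  (trans (∑ˢ-cong _ _ (λ S → cong χ (∧-zeroʳ (Q (inside ∷ S))))) (∑ˢ-zero {n}))
  (#ˢ-sized-zero (Q ∘ (outside ∷_)))

∧-swapˡ : ∀ a b c → (a ∧ b) ∧ c ≡ b ∧ (a ∧ c)
∧-swapˡ true  b c = refl
∧-swapˡ false b c = sym (∧-zeroʳ b)

count-distinct : ∀ m (P : Subset n → Bool) →
  count m (λ v → distinct v ∧ P (elements v)) ≡ m ! * #ˢ (λ S → P S ∧ sized S m)
count-distinct zero P = sym (trans (+-identityʳ _) (#ˢ-sized-zero P))
count-distinct {n} (suc m) P = begin
  ∑[ x < n ] count m (λ v → (not (lookup (elements v) x) ∧ distinct v) ∧ P (elements v [ x ]≔ inside))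
    ≡⟨ sum-cong-≗ (λ x → count-cong m _ (λ v → distinct v ∧ Pₓ x (elements v))
                            (λ v → ∧-swapˡ (not (lookup (elements v) x)) (distinct v) _)) ⟩
  ∑[ x < n ] count m (λ v → distinct v ∧ Pₓ x (elements v))
    ≡⟨ sum-cong-≗ (λ x → count-distinct m (Pₓ x)) ⟩
  ∑[ x < n ] (m ! * #ˢ (λ S → Pₓ x S ∧ sized S m))
    ≡⟨ *-distribˡ-sum (m !) (λ x → #ˢ (λ S → Pₓ x S ∧ sized S m)) ⟨
  m ! * ∑[ x < n ] #ˢ (λ S → Pₓ x S ∧ sized S m)
    ≡⟨ cong (m ! *_) (sum-cong-≗ λ x →
         trans (∑ˢ-cong _ _ (cong χ ∘ shift-size x)) (#ˢ-insert x Q)) ⟩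
  m ! * ∑[ x < n ] #ˢ (λ S → lookup S x ∧ Q S)
    ≡⟨ cong (m ! *_) (∑-#ˢ-member (suc m) Q Q-sized) ⟩
  m ! * (#ˢ Q * suc m)
    ≡⟨ cong (m ! *_) (*-comm (#ˢ Q) (suc m)) ⟩
  m ! * (suc m * #ˢ Q)
    ≡⟨ *-assoc (m !) (suc m) _ ⟨
  m ! * suc m * #ˢ Q
    ≡⟨ cong (_* #ˢ Q) (*-comm (m !) (suc m)) ⟩
  suc m ! * #ˢ Q ∎
  where
  open ≡-Reasoning
  Pₓ : Fin n → Subset n → Bool
  Pₓ x S = not (lookup S x) ∧ P (S [ x ]≔ inside)
  Q : Subset n → Bool
  Q S = P S ∧ sized S (suc m)
  Q-sized : ∀ S → Q S ≡ true → ∣ S ∣ ≡ suc m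
  Q-sized S QS = sized⇒∣∣≡ S (∧-true⁻ʳ {P S} QS)
  shift-size : ∀ x S → Pₓ x S ∧ sized S m ≡ not (lookup S x) ∧ Q (S [ x ]≔ inside)
  shift-size x S with lookup S x in Sx≡
  ... | true  = refl
  ... | false = cong (P (S [ x ]≔ inside) ∧_) (sym (begin
    ⌊ ∣ S [ x ]≔ inside ∣ ≟ suc m ⌋  ≡⟨ cong (λ s → ⌊ s ≟ suc m ⌋) (∣insert∣ x S Sx≡) ⟩
    ⌊ suc ∣ S ∣ ≟ suc m ⌋            ≡⟨ ⌊suc≟suc⌋ ∣ S ∣ m ⟩
    ⌊ ∣ S ∣ ≟ m ⌋                    ∎))

length-filterᵇ-map : ∀ {A B : Set} (Q : B → Bool) (h : A → B) xs →
  length (filterᵇ Q (map h xs)) ≡ length (filterᵇ (Q ∘ h) xs)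
length-filterᵇ-map Q h []       = refl
length-filterᵇ-map Q h (x ∷ xs) with Q (h x)
... | true  = cong suc (length-filterᵇ-map Q h xs)
... | false = length-filterᵇ-map Q h xs

length-filterᵇ-allSubsets : ∀ n (Q : Subset n → Bool) → length (filterᵇ Q (allSubsets n)) ≡ #ˢ Q
length-filterᵇ-allSubsets zero    Q with Q []
... | true  = refl
... | false = refl
length-filterᵇ-allSubsets (suc n) Q = begin
  length (filterᵇ Q (ins ++ outs))
    ≡⟨ cong length (filter-++ _ ins outs) ⟩
  length (filterᵇ Q ins ++ filterᵇ Q outs)
    ≡⟨ length-++ (filterᵇ Q ins) ⟩
  length (filterᵇ Q ins) + length (filterᵇ Q outs)
    ≡⟨ cong₂ _+_ (trans (length-filterᵇ-map Q _ (allSubsets n)) (length-filterᵇ-allSubsets n _))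
                 (trans (length-filterᵇ-map Q _ (allSubsets n)) (length-filterᵇ-allSubsets n _)) ⟩
  #ˢ Q ∎
  where
  open ≡-Reasoning
  ins outs : List (Subset (suc n))
  ins  = map (inside ∷_) (allSubsets n)
  outs = map (outside ∷_) (allSubsets n)

#orderedFaces≡!*f : (Δ : SimplicialComplex n) → ∀ m → #orderedFaces Δ m ≡ m ! * f m Δ
#orderedFaces≡!*f {n} Δ m =
  trans (count-distinct m (isFace Δ)) (cong (m ! *_) (sym (length-filterᵇ-allSubsets n _)))

-- Iterating the shrinking inequality

module _ (b : ℕ → ℕ)
  (shrink : ∀ m → b (2 + m) ^ suc m ≤ pred (b (suc m)) * b (suc m) ^ suc m) where

  shrink-< : ∀ m → 0 < b (suc m) → b (2 + m) ^ suc m < b (suc m) ^ (2 + m)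
  shrink-< m b>0 = ≤-<-trans (shrink m) (*-monoˡ-< (b (suc m) ^ suc m) pred[b]<b)
    where
    instance b≢0 = >-nonZero b>0
    instance bʳ≢0 = m^n≢0 (b (suc m)) (suc m)
    pred[b]<b : pred (b (suc m)) < b (suc m)
    pred[b]<b = m≤pred[n]⇒suc[m]≤n ≤-refl

  shrink-zero : ∀ m → b (suc m) ≡ 0 → b (2 + m) ≡ 0
  shrink-zero m b≡0 = m^n≡0⇒m≡0 _ (suc m)
    (n≤0⇒n≡0 (subst (b (2 + m) ^ suc m ≤_) (cong (λ z → pred z * z ^ suc m) b≡0) (shrink m)))

  root-decreasing : ∀ {p k} → p <′ k → 0 < b (suc p) → b (suc k) ^ suc p < b (suc p) ^ suc k
  root-decreasing {p} ≤′-refl b>0 = shrink-< p b>0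
  root-decreasing {p} {suc k} (≤′-step p<k) b>0 with b (suc k) in bk≡
  ... | zero = subst (λ z → z ^ suc p < b (suc p) ^ (2 + k)) (sym (shrink-zero k bk≡))
                 (m^n>0 _ {{>-nonZero b>0}} (2 + k))
  ... | suc _ = ^-cancelʳ-< (suc k) (begin-strict
    (b (2 + k) ^ suc p) ^ suc k  ≡⟨ ^-^-comm (b (2 + k)) (suc p) (suc k) ⟩
    (b (2 + k) ^ suc k) ^ suc p  <⟨ ^-monoˡ-< (suc p) (shrink-< k (subst (0 <_) (sym bk≡) z<s)) ⟩
    (b (suc k) ^ (2 + k)) ^ suc p ≡⟨ ^-^-comm (b (suc k)) (2 + k) (suc p) ⟩
    (b (suc k) ^ suc p) ^ (2 + k) ≤⟨ ^-monoˡ-≤ (2 + k) (<⇒≤ (root-decreasing p<k b>0)) ⟩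
    (b (suc p) ^ suc k) ^ (2 + k) ≡⟨ ^-^-comm (b (suc p)) (suc k) (2 + k) ⟩
    (b (suc p) ^ (2 + k)) ^ suc k ∎)
    where open ≤-Reasoning

corollary1p2 : ∀ {n : ℕ} (Δ : SimplicialComplex n) (k p : ℕ) →
    0 < p → p < k → 0 < f p Δ →
    ((k !) ^ p) * (f k Δ ^ p) < ((p !) * f p Δ) ^ k
corollary1p2 Δ (suc k) (suc p) _ (s≤s p<k) f>0 = subst₂ _<_
  (trans (cong (_^ suc p) (#orderedFaces≡!*f Δ (suc k))) (^-distribʳ-* (suc k !) _ (suc p)))
  (cong (_^ suc k) (#orderedFaces≡!*f Δ (suc p)))
  (root-decreasing (#orderedFaces Δ) (orderedFaces-shrink Δ) (<⇒<′ p<k) ordered>0)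
  where
  ordered>0 : 0 < #orderedFaces Δ (suc p)
  ordered>0 = subst (0 <_) (sym (#orderedFaces≡!*f Δ (suc p))) (*-mono-≤ (1≤n! (suc p)) f>0)
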